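{- If there exists a Hadamard matrix of order $n$, then there exists a set of $2^nn!$ mutually quasi-unbiased Hadamard matrices of order $n$ with parameters $(1,n^2)$, and $2^nn!$ is the maximum size among sets of mutually quasi-unbiased Hadamard matrices of order $n$ with parameters $(1,n^2)$.
   Context: A Hadamard matrix of order $n$ is an $n\times n$ $(\pm1)$-matrix $H$ with $HH^T=nI_n$. A weighing matrix of order $n$ and weight $k$ is an $n\times n$ $(1,-1,0)$-matrix $W$ with $WW^T=kI_n$. Hadamard matrices $H,K$ of order $n$ are quasi-unbiased with parameters $(l,a)$ if $\frac1{\sqrt a}HK^T$ is a weighing matrix of weight $l$; a set of Hadamard matrices is mutually quasi-unbiased if every pair of two distinct members is. -}

module Defs where

open import Data.Nat as ℕ using (ℕ; zero; suc)
open import Data.Integer using (ℤ; +_; -_; _+_; _*_; 0ℤ; 1ℤ)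
open import Data.Fin using (Fin; zero; suc)
open import Data.Product using (Σ; _×_; ∃)
open import Data.Sum using (_⊎_)
open import Relation.Binary.PropositionalEquality using (_≡_)
open import Relation.Nullary using (¬_)

Matrix : ℕ → Set
Matrix n = Fin n → Fin n → ℤ

sumFin : (n : ℕ) → (Fin n → ℤ) → ℤ
sumFin zero    f = 0ℤ
sumFin (suc n) f = f zero + sumFin n (λ i → f (suc i))

mulT : {n : ℕ} → Matrix n → Matrix n → Matrix n
mulT {n} A B i j = sumFin n (λ k → A i k * B j k)

scalarId : {n : ℕ} → ℤ → Matrix n
scalarId c i j with Data.Fin._≟_ i j
  where import Data.Fin
... | Relation.Nullary.yes _ = c
... | Relation.Nullary.no  _ = 0ℤ

IsHadamard : (n : ℕ) → Matrix n → Set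
IsHadamard n H =
  (∀ i j → H i j ≡ 1ℤ ⊎ H i j ≡ - 1ℤ) ×
  (∀ i j → mulT H H i j ≡ scalarId (+ n) i j)

IsWeighing : (n k : ℕ) → Matrix n → Set
IsWeighing n k W =
  (∀ i j → W i j ≡ 1ℤ ⊎ (W i j ≡ - 1ℤ ⊎ W i j ≡ 0ℤ)) ×
  (∀ i j → mulT W W i j ≡ scalarId (+ k) i j)

-- Hadamard matrices H, K of order n are quasi-unbiased with parameters (l, a)
-- if (1/√a) H Kᵀ is a weighing matrix of weight l.  Here √a must be the
-- nonnegative integer s with s*s = a (H Kᵀ has integer entries, W has
-- entries in {0,±1}), and "(1/√a) H Kᵀ = W" is written as H Kᵀ = s W.
QuasiUnbiased : (n l a : ℕ) → Matrix n → Matrix n → Set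
QuasiUnbiased n l a H K =
  IsHadamard n H × IsHadamard n K ×
  Σ ℕ (λ s → (s ℕ.* s ≡ a) ×
    Σ (Matrix n) (λ W → IsWeighing n l W ×
      (∀ i j → mulT H K i j ≡ + s * W i j)))

SameMatrix : {n : ℕ} → Matrix n → Matrix n → Set
SameMatrix A B = ∀ i j → A i j ≡ B i j

MutuallyQU : (n l a m : ℕ) → (Fin m → Matrix n) → Set
MutuallyQU n l a m F =
  (∀ i → IsHadamard n (F i)) ×
  (∀ i j → ¬ i ≡ j → ¬ SameMatrix (F i) (F j)) ×
  (∀ i j → ¬ i ≡ j → QuasiUnbiased n l a (F i) (F j))

-- Weight-1 weighing matrices are the signed permutation matrices P.  For a
-- Hadamard matrix H of order n, P H and Q H are again Hadamard, and
-- (P H)(Q H)ᵀ = n P Qᵀ with P Qᵀ a signed permutation matrix, so the 2ⁿ n!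
-- matrices P H are mutually quasi-unbiased with parameters (1, n²); they are
-- distinct because no row of H is ± another row.  Conversely, if K is
-- quasi-unbiased with H then K Hᵀ = n W, so row i of K has inner product n
-- with ±(row k of H) for the k where W i k ≠ 0; both being (±1)-vectors of
-- length n, they are equal.  Hence K = P H, and the members of a mutually
-- quasi-unbiased family are distinct signed row permutations of its first one.
module Submission where

open import Defs
open import Data.Nat using (ℕ; _*_; _^_; _≤_; _!)
open import Data.Fin using (Fin)
open import Data.Product using (Σ; _×_)

open import Data.Bool using (Bool; true; false)
open import Data.Empty using (⊥-elim)
open import Data.Fin as Fin using (zero; suc; punchIn; punchOut)
import Data.Fin.Properties as Fin
open import Data.Integer as ℤ using (ℤ; +_; -_; 0ℤ; 1ℤ; -1ℤ)
import Data.Integer.Properties as ℤ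
open import Algebra.Properties.CommutativeSemigroup ℤ.*-commutativeSemigroup
  using (x∙yz≈y∙xz) renaming (interchange to *-interchange)
open import Data.Nat as ℕ using (zero; suc; z≤n)
import Data.Nat.Properties as ℕ
import Data.Nat.Tactic.RingSolver as ℕ-Solver
open import Data.Product using (_,_; proj₁; proj₂)
open import Data.Product.Function.NonDependent.Propositional using (_×-↔_)
open import Data.Sum using (_⊎_; inj₁; inj₂)
open import Data.Unit using (⊤; tt)
open import Function using (_∘_)
open import Function.Bundles using (_↔_; Inverse; Injection)
open import Function.Definitions using (Injective)
open import Function.Properties.Inverse using (↔-refl; ↔-sym; ↔⇒↣)
open import Function.Related.Propositional using (module EquationalReasoning; bijection)
open import Relation.Binary.Definitions using (tri<; tri≈; tri>)
open import Relation.Binary.PropositionalEquality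
open import Relation.Nullary using (¬_; Dec; yes; no)

private variable
  m n : ℕ

δ : Matrix n
δ = scalarId 1ℤ

module _ (c : ℤ) where

  scalarId-diag : (a : Fin n) → scalarId c a a ≡ c
  scalarId-diag a with a Fin.≟ a
  ... | yes _  = refl
  ... | no a≢a = ⊥-elim (a≢a refl)

  scalarId-offdiag : {a b : Fin n} → a ≢ b → scalarId c a b ≡ 0ℤ
  scalarId-offdiag {a = a} {b} a≢b with a Fin.≟ b
  ... | yes a≡b = ⊥-elim (a≢b a≡b)
  ... | no _    = refl

  scalarId≡*δ : (a b : Fin n) → scalarId c a b ≡ c ℤ.* δ a b
  scalarId≡*δ a b with a Fin.≟ b
  ... | yes _ = sym (ℤ.*-identityʳ c)
  ... | no _  = sym (ℤ.*-zeroʳ c)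

  scalarId-sym : (a b : Fin n) → scalarId c a b ≡ scalarId c b a
  scalarId-sym a b with a Fin.≟ b
  ... | yes refl = sym (scalarId-diag a)
  ... | no a≢b   = sym (scalarId-offdiag (≢-sym a≢b))

  scalarId-reindex : (f : Fin m → Fin n) → Injective _≡_ _≡_ f →
                     ∀ a b → scalarId c (f a) (f b) ≡ scalarId c a b
  scalarId-reindex f f-injective a b with a Fin.≟ b
  ... | yes refl = scalarId-diag (f a)
  ... | no a≢b   = scalarId-offdiag (a≢b ∘ f-injective)

IsBit : ℤ → Set
IsBit x = x ≡ 1ℤ ⊎ x ≡ 0ℤ

δ-IsBit : (a b : Fin n) → IsBit (δ a b)
δ-IsBit a b with a Fin.≟ b
... | yes _ = inj₁ refl
... | no _  = inj₂ refl

sumFin-cong : ∀ n {f g : Fin n → ℤ} → (∀ k → f k ≡ g k) → sumFin n f ≡ sumFin n g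
sumFin-cong zero    f≗g = refl
sumFin-cong (suc n) f≗g = cong₂ ℤ._+_ (f≗g zero) (sumFin-cong n (f≗g ∘ suc))

sumFin-*ˡ : ∀ n c (f : Fin n → ℤ) → sumFin n (λ k → c ℤ.* f k) ≡ c ℤ.* sumFin n f
sumFin-*ˡ zero    c f = sym (ℤ.*-zeroʳ c)
sumFin-*ˡ (suc n) c f =
  trans (cong (ℤ._+_ (c ℤ.* f zero)) (sumFin-*ˡ n c (f ∘ suc))) (sym (ℤ.*-distribˡ-+ c (f zero) _))

sumFin-*-* : ∀ n x y (f g : Fin n → ℤ) →
  sumFin n (λ k → (x ℤ.* f k) ℤ.* (y ℤ.* g k))
    ≡ (x ℤ.* y) ℤ.* sumFin n (λ k → f k ℤ.* g k)
sumFin-*-* n x y f g =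
  trans (sumFin-cong n (λ k → *-interchange x (f k) y (g k))) (sumFin-*ˡ n (x ℤ.* y) _)

sumFin-zero : ∀ n → sumFin n (λ _ → 0ℤ) ≡ 0ℤ
sumFin-zero zero    = refl
sumFin-zero (suc n) = trans (ℤ.+-identityˡ _) (sumFin-zero n)

sumFin-δ : ∀ n (a : Fin n) (f : Fin n → ℤ) → sumFin n (λ k → δ a k ℤ.* f k) ≡ f a
sumFin-δ (suc n) zero f = begin
  1ℤ ℤ.* f zero ℤ.+ sumFin n (λ _ → 0ℤ)
    ≡⟨ cong₂ ℤ._+_ (ℤ.*-identityˡ (f zero)) (sumFin-zero n) ⟩
  f zero ℤ.+ 0ℤ                         ≡⟨ ℤ.+-identityʳ (f zero) ⟩
  f zero                                ∎
  where open ≡-Reasoning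
sumFin-δ (suc n) (suc a) f = begin
  0ℤ ℤ.+ sumFin n (λ k → δ (suc a) (suc k) ℤ.* f (suc k)) ≡⟨ ℤ.+-identityˡ _ ⟩
  sumFin n (λ k → δ (suc a) (suc k) ℤ.* f (suc k))
    ≡⟨ sumFin-cong n (λ k → cong (ℤ._* f (suc k)) (δ-suc k)) ⟩
  sumFin n (λ k → δ a k ℤ.* f (suc k))                    ≡⟨ sumFin-δ n a (f ∘ suc) ⟩
  f (suc a)                                               ∎
  where
  open ≡-Reasoning
  δ-suc : ∀ k → δ (suc a) (suc k) ≡ δ a k
  δ-suc = scalarId-reindex 1ℤ suc Fin.suc-injective a

sumFin-nonzero : ∀ n (f : Fin n → ℤ) → sumFin n f ≢ 0ℤ → Σ (Fin n) (λ k → f k ≢ 0ℤ)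
sumFin-nonzero zero    f Σf≢0 = ⊥-elim (Σf≢0 refl)
sumFin-nonzero (suc n) f Σf≢0 with f zero ℤ.≟ 0ℤ
... | no f0≢0  = zero , f0≢0
... | yes f0≡0 =
  let k , fk≢0 = sumFin-nonzero n (f ∘ suc) (Σf≢0 ∘ cong₂ ℤ._+_ f0≡0) in suc k , fk≢0

+-≤-≡⇒≡ˡ : ∀ {x y a b} → x ℤ.≤ a → y ℤ.≤ b → x ℤ.+ y ≡ a ℤ.+ b → x ≡ a
+-≤-≡⇒≡ˡ {x} {a = a} x≤a y≤b x+y≡a+b with x ℤ.≟ a
... | yes x≡a = x≡a
... | no x≢a  = ⊥-elim (ℤ.<⇒≢ (ℤ.+-mono-<-≤ (ℤ.≤∧≢⇒< x≤a x≢a) y≤b) x+y≡a+b)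

sumFin-≤ : ∀ n (f : Fin n → ℤ) → (∀ k → f k ℤ.≤ 1ℤ) → sumFin n f ℤ.≤ + n
sumFin-≤ zero    f f≤1 = ℤ.≤-refl
sumFin-≤ (suc n) f f≤1 = ℤ.+-mono-≤ (f≤1 zero) (sumFin-≤ n (f ∘ suc) (f≤1 ∘ suc))

sumFin≡n⇒≡1 : ∀ n (f : Fin n → ℤ) → (∀ k → f k ℤ.≤ 1ℤ) →
              sumFin n f ≡ + n → ∀ k → f k ≡ 1ℤ
sumFin≡n⇒≡1 (suc n) f f≤1 Σf≡1+n = λ
  { zero    → +-≤-≡⇒≡ˡ (f≤1 zero) tail≤n Σf≡1+n
  ; (suc k) → sumFin≡n⇒≡1 n (f ∘ suc) (f≤1 ∘ suc) tail≡n k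
  }
  where
  tail≤n : sumFin n (f ∘ suc) ℤ.≤ + n
  tail≤n = sumFin-≤ n (f ∘ suc) (f≤1 ∘ suc)
  tail≡n : sumFin n (f ∘ suc) ≡ + n
  tail≡n = +-≤-≡⇒≡ˡ tail≤n (f≤1 zero)
             (trans (ℤ.+-comm _ (f zero)) (trans Σf≡1+n (ℤ.+-comm 1ℤ (+ n))))

IsSign : ℤ → Set
IsSign x = x ≡ 1ℤ ⊎ x ≡ - 1ℤ

IsSign-≤1 : ∀ {x} → IsSign x → x ℤ.≤ 1ℤ
IsSign-≤1 (inj₁ refl) = ℤ.≤-refl
IsSign-≤1 (inj₂ refl) = ℤ.-≤+

IsSign-* : ∀ {x y} → IsSign x → IsSign y → IsSign (x ℤ.* y)
IsSign-* (inj₁ refl) (inj₁ refl) = inj₁ refl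
IsSign-* (inj₁ refl) (inj₂ refl) = inj₂ refl
IsSign-* (inj₂ refl) (inj₁ refl) = inj₂ refl
IsSign-* (inj₂ refl) (inj₂ refl) = inj₁ refl

IsSign-*≡1⇒≡ : ∀ {x y} → IsSign x → IsSign y → x ℤ.* y ≡ 1ℤ → x ≡ y
IsSign-*≡1⇒≡ (inj₁ refl) (inj₁ refl) _  = refl
IsSign-*≡1⇒≡ (inj₂ refl) (inj₂ refl) _  = refl
IsSign-*≡1⇒≡ (inj₁ refl) (inj₂ refl) ()
IsSign-*≡1⇒≡ (inj₂ refl) (inj₁ refl) ()

IsWeighingEntry : ℤ → Set
IsWeighingEntry x = x ≡ 1ℤ ⊎ (x ≡ - 1ℤ ⊎ x ≡ 0ℤ)

IsSign-*-IsBit : ∀ {x y} → IsSign x → IsBit y → IsWeighingEntry (x ℤ.* y)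
IsSign-*-IsBit (inj₁ refl) (inj₁ refl) = inj₁ refl
IsSign-*-IsBit (inj₂ refl) (inj₁ refl) = inj₂ (inj₁ refl)
IsSign-*-IsBit (inj₁ refl) (inj₂ refl) = inj₂ (inj₂ refl)
IsSign-*-IsBit (inj₂ refl) (inj₂ refl) = inj₂ (inj₂ refl)

IsWeighingEntry⇒IsSign : ∀ {x} → IsWeighingEntry x → x ℤ.* x ≢ 0ℤ → IsSign x
IsWeighingEntry⇒IsSign (inj₁ x≡1)         _    = inj₁ x≡1
IsWeighingEntry⇒IsSign (inj₂ (inj₁ x≡-1)) _    = inj₂ x≡-1
IsWeighingEntry⇒IsSign (inj₂ (inj₂ refl)) xx≢0 = ⊥-elim (xx≢0 refl)

sgn : Bool → ℤ
sgn true  = 1ℤ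
sgn false = -1ℤ

sgn-IsSign : ∀ σ → IsSign (sgn σ)
sgn-IsSign true  = inj₁ refl
sgn-IsSign false = inj₂ refl

IsSign⇒sgn : ∀ {x} → IsSign x → Σ Bool (λ σ → sgn σ ≡ x)
IsSign⇒sgn (inj₁ refl) = true , refl
IsSign⇒sgn (inj₂ refl) = false , refl

sgn-*-sgn : ∀ σ → sgn σ ℤ.* sgn σ ≡ 1ℤ
sgn-*-sgn true  = refl
sgn-*-sgn false = refl

sgn-*≡1⇒≡ : ∀ σ τ → sgn σ ℤ.* sgn τ ≡ 1ℤ → σ ≡ τ
sgn-*≡1⇒≡ true  true  _  = refl
sgn-*≡1⇒≡ false false _  = refl
sgn-*≡1⇒≡ true  false ()
sgn-*≡1⇒≡ false true  ()

sgn-*-sgn-* : ∀ σ a b → (sgn σ ℤ.* a) ℤ.* (sgn σ ℤ.* b) ≡ a ℤ.* b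
sgn-*-sgn-* σ a b = begin
  (sgn σ ℤ.* a) ℤ.* (sgn σ ℤ.* b) ≡⟨ *-interchange (sgn σ) a (sgn σ) b ⟩
  (sgn σ ℤ.* sgn σ) ℤ.* (a ℤ.* b) ≡⟨ cong (ℤ._* (a ℤ.* b)) (sgn-*-sgn σ) ⟩
  1ℤ ℤ.* (a ℤ.* b)                ≡⟨ ℤ.*-identityˡ _ ⟩
  a ℤ.* b                         ∎
  where open ≡-Reasoning

-- A signed permutation of Fin (suc n) as a Lehmer code: the image of 0 and its
-- sign, then the signed permutation of Fin n that punchIn turns into the
-- images of 1, …, n.
SignedPerm : ℕ → Set
SignedPerm zero    = ⊤
SignedPerm (suc n) = Fin (suc n) × Bool × SignedPerm n

perm : SignedPerm n → Fin n → Fin n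
perm {suc n} (d , _ , c) zero    = d
perm {suc n} (d , _ , c) (suc i) = punchIn d (perm c i)

signs : SignedPerm n → Fin n → Bool
signs {suc n} (_ , σ , c) zero    = σ
signs {suc n} (_ , σ , c) (suc i) = signs c i

perm-injective : (c : SignedPerm n) → Injective _≡_ _≡_ (perm c)
perm-injective {suc n} (d , _ , c) {zero}  {zero}  _  = refl
perm-injective {suc n} (d , _ , c) {zero}  {suc j} eq = ⊥-elim (Fin.punchInᵢ≢i d (perm c j) (sym eq))
perm-injective {suc n} (d , _ , c) {suc i} {zero}  eq = ⊥-elim (Fin.punchInᵢ≢i d (perm c i) eq)
perm-injective {suc n} (d , _ , c) {suc i} {suc j} eq =
  cong suc (perm-injective c (Fin.punchIn-injective d _ _ eq))

perm-surjective : (c : SignedPerm n) → ∀ y → Σ (Fin n) (λ x → perm c x ≡ y)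
perm-surjective {suc n} (d , _ , c) y with d Fin.≟ y
... | yes d≡y = zero , d≡y
... | no d≢y  =
  let x , eq = perm-surjective c (punchOut d≢y) in
  suc x , trans (cong (punchIn d) eq) (Fin.punchIn-punchOut d≢y)

SignedPerm-≡ : (c c′ : SignedPerm n) →
  (∀ i → perm c i ≡ perm c′ i) → (∀ i → signs c i ≡ signs c′ i) → c ≡ c′
SignedPerm-≡ {zero}  tt tt _ _ = refl
SignedPerm-≡ {suc n} (d , σ , c) (d′ , σ′ , c′) perm≗ signs≗ with perm≗ zero | signs≗ zero
... | refl | refl = cong (λ c → d , σ , c)
  (SignedPerm-≡ c c′ (λ i → Fin.punchIn-injective d _ _ (perm≗ (suc i))) (signs≗ ∘ suc))

identity : ∀ n → SignedPerm n
identity zero    = tt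
identity (suc n) = zero , true , identity n

perm-identity : ∀ n i → perm (identity n) i ≡ i
perm-identity (suc n) zero    = refl
perm-identity (suc n) (suc i) = cong suc (perm-identity n i)

signs-identity : ∀ n i → signs (identity n) i ≡ true
signs-identity (suc n) zero    = refl
signs-identity (suc n) (suc i) = signs-identity n i

module _ (r : Fin (suc n) → Fin (suc n)) (r-injective : Injective _≡_ _≡_ r) where

  r0≢r[1+i] : ∀ i → r zero ≢ r (suc i)
  r0≢r[1+i] i = Fin.0≢1+n ∘ r-injective

  punchOutTail : Fin n → Fin n
  punchOutTail i = punchOut (r0≢r[1+i] i)

  punchOutTail-injective : Injective _≡_ _≡_ punchOutTail
  punchOutTail-injective eq =
    Fin.suc-injective (r-injective (Fin.punchOut-injective (r0≢r[1+i] _) (r0≢r[1+i] _) eq))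

fromInjection : (r : Fin n → Fin n) → Injective _≡_ _≡_ r → (Fin n → Bool) → SignedPerm n
fromInjection {zero}  r r-injective s = tt
fromInjection {suc n} r r-injective s =
  r zero , s zero ,
  fromInjection (punchOutTail r r-injective) (punchOutTail-injective r r-injective) (s ∘ suc)

private variable
  r : Fin n → Fin n
  r-injective : Injective _≡_ _≡_ r
  s : Fin n → Bool

perm-fromInjection : ∀ i → perm (fromInjection r r-injective s) i ≡ r i
perm-fromInjection {suc n} {r} {r-injective} zero    = refl
perm-fromInjection {suc n} {r} {r-injective} (suc i) =
  trans (cong (punchIn (r zero)) (perm-fromInjection i))
        (Fin.punchIn-punchOut (r0≢r[1+i] r r-injective i))

signs-fromInjection : ∀ i → signs (fromInjection r r-injective s) i ≡ s i
signs-fromInjection {suc n} zero    = refl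
signs-fromInjection {suc n} (suc i) = signs-fromInjection i

SignedPerm↔Fin : ∀ n → SignedPerm n ↔ Fin (2 ^ n * n !)
SignedPerm↔Fin zero    = ↔-sym Fin.1↔⊤
SignedPerm↔Fin (suc n) = begin
  (Fin (suc n) × Bool × SignedPerm n)       ↔⟨ ↔-refl ×-↔ ↔-sym Fin.2↔Bool ×-↔ SignedPerm↔Fin n ⟩
  (Fin (suc n) × Fin 2 × Fin (2 ^ n * n !)) ↔⟨ ↔-refl ×-↔ ↔-sym Fin.*↔× ⟩
  (Fin (suc n) × Fin (2 * (2 ^ n * n !)))   ↔⟨ ↔-sym Fin.*↔× ⟩
  Fin (suc n * (2 * (2 ^ n * n !)))         ≡⟨ cong Fin (count n (2 ^ n) (n !)) ⟩
  Fin (2 ^ suc n * suc n !)                 ∎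
  where
  open EquationalReasoning {k = bijection}
  count : ∀ k p f → suc k * (2 * (p * f)) ≡ (2 * p) * (f ℕ.+ k * f)
  count = ℕ-Solver.solve-∀

Orthogonal : ℤ → Matrix n → Set
Orthogonal t A = ∀ i j → mulT A A i j ≡ scalarId t i j

permuteRows : SignedPerm n → Matrix n → Matrix n
permuteRows c A i k = sgn (signs c i) ℤ.* A (perm c i) k

-- Pᵀ for the signed permutation matrix P with permuteRows c A = P A.
permMatrixᵀ : SignedPerm n → Matrix n
permMatrixᵀ c x k = sgn (signs c k) ℤ.* δ x (perm c k)

mulT-permuteRows : ∀ (c c′ : SignedPerm n) (A B : Matrix n) i j →
  mulT (permuteRows c A) (permuteRows c′ B) i j
    ≡ (sgn (signs c i) ℤ.* sgn (signs c′ j)) ℤ.* mulT A B (perm c i) (perm c′ j)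
mulT-permuteRows {n} c c′ A B i j =
  sumFin-*-* n (sgn (signs c i)) (sgn (signs c′ j)) (A (perm c i)) (B (perm c′ j))

sgn-*-scalarId : ∀ (s : Fin n → Bool) t i j →
  (sgn (s i) ℤ.* sgn (s j)) ℤ.* scalarId t i j ≡ scalarId t i j
sgn-*-scalarId s t i j with i Fin.≟ j
... | yes refl = trans (cong (ℤ._* t) (sgn-*-sgn (s i))) (ℤ.*-identityˡ t)
... | no _     = ℤ.*-zeroʳ (sgn (s i) ℤ.* sgn (s j))

permuteRows-Orthogonal : ∀ (c : SignedPerm n) t A →
  Orthogonal t A → Orthogonal t (permuteRows c A)
permuteRows-Orthogonal c t A A-orth i j = begin
  mulT (permuteRows c A) (permuteRows c A) i j ≡⟨ mulT-permuteRows c c A A i j ⟩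
  sᵢⱼ ℤ.* mulT A A (perm c i) (perm c j)       ≡⟨ cong (sᵢⱼ ℤ.*_) (A-orth _ _) ⟩
  sᵢⱼ ℤ.* scalarId t (perm c i) (perm c j)
    ≡⟨ cong (sᵢⱼ ℤ.*_) (scalarId-reindex t (perm c) (perm-injective c) i j) ⟩
  sᵢⱼ ℤ.* scalarId t i j                       ≡⟨ sgn-*-scalarId (signs c) t i j ⟩
  scalarId t i j                               ∎
  where
  open ≡-Reasoning
  sᵢⱼ : ℤ
  sᵢⱼ = sgn (signs c i) ℤ.* sgn (signs c j)

permuteRows-IsHadamard : ∀ c H → IsHadamard n H → IsHadamard n (permuteRows c H)
permuteRows-IsHadamard {n} c H (H-entries , H-orth) =
  (λ i k → IsSign-* (sgn-IsSign (signs c i)) (H-entries _ _)) ,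
  permuteRows-Orthogonal c (+ n) H H-orth

permMatrixᵀ-Orthogonal : (c : SignedPerm n) → Orthogonal 1ℤ (permMatrixᵀ c)
permMatrixᵀ-Orthogonal {n} c x y with perm-surjective c x | perm-surjective c y
... | u , refl | v , refl = begin
  sumFin n (λ k → permMatrixᵀ c (perm c u) k ℤ.* permMatrixᵀ c (perm c v) k)
    ≡⟨ sumFin-cong n (λ k → trans (sgn-*-sgn-* (signs c k) _ _)
                                  (cong₂ ℤ._*_ (δ-perm u k) (δ-perm v k))) ⟩
  sumFin n (λ k → δ u k ℤ.* δ v k) ≡⟨ sumFin-δ n u (δ v) ⟩
  δ v u                           ≡⟨ scalarId-sym 1ℤ v u ⟩
  δ u v                           ≡⟨ δ-perm u v ⟨
  δ (perm c u) (perm c v)         ∎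
  where
  open ≡-Reasoning
  δ-perm : ∀ a b → δ (perm c a) (perm c b) ≡ δ a b
  δ-perm = scalarId-reindex 1ℤ (perm c) (perm-injective c)

permuteRows-permMatrixᵀ-IsWeighing : (c c′ : SignedPerm n) →
  IsWeighing n 1 (permuteRows c (permMatrixᵀ c′))
permuteRows-permMatrixᵀ-IsWeighing c c′ =
  (λ i k → subst IsWeighingEntry (ℤ.*-assoc (sgn (signs c i)) (sgn (signs c′ k)) _)
             (IsSign-*-IsBit (IsSign-* (sgn-IsSign (signs c i)) (sgn-IsSign (signs c′ k)))
                             (δ-IsBit (perm c i) (perm c′ k)))) ,
  permuteRows-Orthogonal c 1ℤ (permMatrixᵀ c′) (permMatrixᵀ-Orthogonal c′)

permuteRows-QuasiUnbiased : ∀ H → IsHadamard n H → ∀ c c′ →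
  QuasiUnbiased n 1 (n * n) (permuteRows c H) (permuteRows c′ H)
permuteRows-QuasiUnbiased {n} H H-had@(_ , H-orth) c c′ =
  permuteRows-IsHadamard c H H-had , permuteRows-IsHadamard c′ H H-had ,
  n , refl , permuteRows c (permMatrixᵀ c′) , permuteRows-permMatrixᵀ-IsWeighing c c′ , product
  where
  product : ∀ i j → mulT (permuteRows c H) (permuteRows c′ H) i j
                      ≡ + n ℤ.* permuteRows c (permMatrixᵀ c′) i j
  product i j = begin
    mulT (permuteRows c H) (permuteRows c′ H) i j       ≡⟨ mulT-permuteRows c c′ H H i j ⟩
    (σ ℤ.* τ) ℤ.* mulT H H (perm c i) (perm c′ j)       ≡⟨ cong ((σ ℤ.* τ) ℤ.*_) (H-orth _ _) ⟩
    (σ ℤ.* τ) ℤ.* scalarId (+ n) (perm c i) (perm c′ j) ≡⟨ cong ((σ ℤ.* τ) ℤ.*_) (scalarId≡*δ (+ n) _ _) ⟩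
    (σ ℤ.* τ) ℤ.* (+ n ℤ.* δ (perm c i) (perm c′ j))    ≡⟨ x∙yz≈y∙xz (σ ℤ.* τ) (+ n) _ ⟩
    + n ℤ.* ((σ ℤ.* τ) ℤ.* δ (perm c i) (perm c′ j))    ≡⟨ cong (+ n ℤ.*_) (ℤ.*-assoc σ τ _) ⟩
    + n ℤ.* permuteRows c (permMatrixᵀ c′) i j          ∎
    where
    open ≡-Reasoning
    σ τ : ℤ
    σ = sgn (signs c i)
    τ = sgn (signs c′ j)

-- The inner product of the two signed rows is σ τ n δ a b by orthogonality,
-- and n by the hypothesis.
signedRows-injective : (H : Matrix n) → Orthogonal (+ n) H → ∀ {a b σ τ} →
  (∀ k → sgn σ ℤ.* H a k ≡ sgn τ ℤ.* H b k) → a ≡ b × σ ≡ τ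
signedRows-injective {n@(suc _)} H H-orth {a} {b} {σ} {τ} rows≡ = conclude (a Fin.≟ b)
  where
  sστ : ℤ
  sστ = sgn σ ℤ.* sgn τ

  gram : sστ ℤ.* scalarId (+ n) a b ≡ + n
  gram = begin
    sστ ℤ.* scalarId (+ n) a b  ≡⟨ cong (sστ ℤ.*_) (H-orth a b) ⟨
    sστ ℤ.* mulT H H a b        ≡⟨ sumFin-*-* n (sgn σ) (sgn τ) (H a) (H b) ⟨
    sumFin n (λ k → (sgn σ ℤ.* H a k) ℤ.* (sgn τ ℤ.* H b k))
      ≡⟨ sumFin-cong n (λ k → cong (ℤ._* (sgn τ ℤ.* H b k)) (rows≡ k)) ⟩
    sumFin n (λ k → (sgn τ ℤ.* H b k) ℤ.* (sgn τ ℤ.* H b k))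
      ≡⟨ sumFin-cong n (λ k → sgn-*-sgn-* τ (H b k) (H b k)) ⟩
    mulT H H b b                ≡⟨ H-orth b b ⟩
    scalarId (+ n) b b          ≡⟨ scalarId-diag (+ n) b ⟩
    + n                         ∎
    where open ≡-Reasoning

  conclude : Dec (a ≡ b) → a ≡ b × σ ≡ τ
  conclude (yes refl) = refl , sgn-*≡1⇒≡ σ τ (ℤ.*-cancelʳ-≡ sστ 1ℤ (+ n) (begin
    sστ ℤ.* + n                ≡⟨ cong (sστ ℤ.*_) (scalarId-diag (+ n) a) ⟨
    sστ ℤ.* scalarId (+ n) a a ≡⟨ gram ⟩
    + n                        ≡⟨ ℤ.*-identityˡ (+ n) ⟨
    1ℤ ℤ.* + n                 ∎))
    where open ≡-Reasoning
  conclude (no a≢b) with () ← trans (sym (ℤ.*-zeroʳ sστ))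
                                 (trans (cong (sστ ℤ.*_) (sym (scalarId-offdiag (+ n) a≢b))) gram)

permuteRows-injective : (H : Matrix n) → IsHadamard n H → ∀ c c′ →
  SameMatrix (permuteRows c H) (permuteRows c′ H) → c ≡ c′
permuteRows-injective H (_ , H-orth) c c′ same =
  SignedPerm-≡ c c′ (proj₁ ∘ rows-injective) (proj₂ ∘ rows-injective)
  where
  rows-injective : ∀ i → perm c i ≡ perm c′ i × signs c i ≡ signs c′ i
  rows-injective i = signedRows-injective H H-orth (same i)

signedReindexing-injective : (K H : Matrix n) → Orthogonal (+ n) K →
  (ρ : Fin n → Fin n) (ε : Fin n → Bool) → (∀ i t → K i t ≡ sgn (ε i) ℤ.* H (ρ i) t) →
  Injective _≡_ _≡_ ρ
signedReindexing-injective K H K-orth ρ ε K≡εHρ {i} {j} ρi≡ρj =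
  proj₁ (signedRows-injective K K-orth {σ = ε j} {τ = ε i} λ t → begin
    sgn (ε j) ℤ.* K i t                    ≡⟨ cong (sgn (ε j) ℤ.*_) (K≡εHρ i t) ⟩
    sgn (ε j) ℤ.* (sgn (ε i) ℤ.* H (ρ i) t) ≡⟨ x∙yz≈y∙xz (sgn (ε j)) (sgn (ε i)) (H (ρ i) t) ⟩
    sgn (ε i) ℤ.* (sgn (ε j) ℤ.* H (ρ i) t) ≡⟨ cong (λ k → sgn (ε i) ℤ.* (sgn (ε j) ℤ.* H k t)) ρi≡ρj ⟩
    sgn (ε i) ℤ.* (sgn (ε j) ℤ.* H (ρ j) t) ≡⟨ cong (sgn (ε i) ℤ.*_) (K≡εHρ j t) ⟨
    sgn (ε i) ℤ.* K j t                    ∎)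
  where open ≡-Reasoning

m*m≡n*n⇒m≡n : ∀ m n → m * m ≡ n * n → m ≡ n
m*m≡n*n⇒m≡n m n eq with ℕ.<-cmp m n
... | tri< m<n _ _ = ⊥-elim (ℕ.<-irrefl eq (ℕ.*-mono-< m<n m<n))
... | tri≈ _ m≡n _ = m≡n
... | tri> _ _ n<m = ⊥-elim (ℕ.<-irrefl (sym eq) (ℕ.*-mono-< n<m n<m))

module _ {K H : Matrix n} where

  QuasiUnbiased⇒weighing : QuasiUnbiased n 1 (n * n) K H →
    Σ (Matrix n) (λ W → IsWeighing n 1 W × (∀ i j → mulT K H i j ≡ + n ℤ.* W i j))
  QuasiUnbiased⇒weighing (_ , _ , s , s*s≡n*n , W , W-weighing , KHᵀ≡sW) =
    W , W-weighing , λ i j → trans (KHᵀ≡sW i j) (cong (λ s → + s ℤ.* W i j) s≡n)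
    where
    s≡n : s ≡ n
    s≡n = m*m≡n*n⇒m≡n s n s*s≡n*n

  weighingProduct⇒signedRows : IsHadamard n K → IsHadamard n H →
    (W : Matrix n) → IsWeighing n 1 W → (∀ i j → mulT K H i j ≡ + n ℤ.* W i j) →
    ∀ i → Σ (Fin n × Bool) (λ (k , σ) → ∀ t → K i t ≡ sgn σ ℤ.* H k t)
  weighingProduct⇒signedRows (K-entries , _) (H-entries , _) W (W-entries , W-orth) KHᵀ≡nW i =
    (k , σ) , λ t → IsSign-*≡1⇒≡ (K-entries i t) (σH-entry t) (terms≡1 t)
    where
    nonzero : Σ (Fin n) (λ k → W i k ℤ.* W i k ≢ 0ℤ)
    nonzero = sumFin-nonzero n (λ k → W i k ℤ.* W i k)
                (subst (_≢ 0ℤ) (sym (trans (W-orth i i) (scalarId-diag 1ℤ i))) (λ ()))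
    k : Fin n
    k = proj₁ nonzero
    Wik-sign : Σ Bool (λ σ → sgn σ ≡ W i k)
    Wik-sign = IsSign⇒sgn (IsWeighingEntry⇒IsSign (W-entries i k) (proj₂ nonzero))
    σ : Bool
    σ = proj₁ Wik-sign
    σ≡Wik : sgn σ ≡ W i k
    σ≡Wik = proj₂ Wik-sign
    σH-entry : ∀ t → IsSign (sgn σ ℤ.* H k t)
    σH-entry t = IsSign-* (sgn-IsSign σ) (H-entries k t)
    term : Fin n → ℤ
    term t = K i t ℤ.* (sgn σ ℤ.* H k t)
    terms-sum : sumFin n term ≡ + n
    terms-sum = begin
      sumFin n term                                ≡⟨ sumFin-cong n (λ t → x∙yz≈y∙xz (K i t) (sgn σ) (H k t)) ⟩
      sumFin n (λ t → sgn σ ℤ.* (K i t ℤ.* H k t)) ≡⟨ sumFin-*ˡ n (sgn σ) (λ t → K i t ℤ.* H k t) ⟩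
      sgn σ ℤ.* mulT K H i k                       ≡⟨ cong (sgn σ ℤ.*_) (KHᵀ≡nW i k) ⟩
      sgn σ ℤ.* (+ n ℤ.* W i k)                    ≡⟨ cong (λ w → sgn σ ℤ.* (+ n ℤ.* w)) σ≡Wik ⟨
      sgn σ ℤ.* (+ n ℤ.* sgn σ)                    ≡⟨ x∙yz≈y∙xz (sgn σ) (+ n) (sgn σ) ⟩
      + n ℤ.* (sgn σ ℤ.* sgn σ)                    ≡⟨ cong (+ n ℤ.*_) (sgn-*-sgn σ) ⟩
      + n ℤ.* 1ℤ                                   ≡⟨ ℤ.*-identityʳ (+ n) ⟩
      + n                                          ∎
      where open ≡-Reasoning
    terms≡1 : ∀ t → term t ≡ 1ℤ
    terms≡1 = sumFin≡n⇒≡1 n term (λ t → IsSign-≤1 (IsSign-* (K-entries i t) (σH-entry t)))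
                          terms-sum

  QuasiUnbiased⇒permuteRows : QuasiUnbiased n 1 (n * n) K H →
    Σ (SignedPerm n) (λ c → SameMatrix K (permuteRows c H))
  QuasiUnbiased⇒permuteRows qu@(K-had , H-had , _) =
    c , K≡cH
    where
    rows : ∀ i → Σ (Fin n × Bool) (λ (k , σ) → ∀ t → K i t ≡ sgn σ ℤ.* H k t)
    rows with W , W-weighing , KHᵀ≡nW ← QuasiUnbiased⇒weighing qu =
      weighingProduct⇒signedRows K-had H-had W W-weighing KHᵀ≡nW
    ρ : Fin n → Fin n
    ρ i = proj₁ (proj₁ (rows i))
    ε : Fin n → Bool
    ε i = proj₂ (proj₁ (rows i))
    K≡εHρ : ∀ i t → K i t ≡ sgn (ε i) ℤ.* H (ρ i) t
    K≡εHρ i = proj₂ (rows i)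
    ρ-injective : Injective _≡_ _≡_ ρ
    ρ-injective = signedReindexing-injective K H (proj₂ K-had) ρ ε K≡εHρ
    c : SignedPerm n
    c = fromInjection ρ ρ-injective ε
    K≡cH : SameMatrix K (permuteRows c H)
    K≡cH i t = trans (K≡εHρ i t)
      (sym (cong₂ (λ σ k → sgn σ ℤ.* H k t) (signs-fromInjection i) (perm-fromInjection i)))

permuteRows-identity : (A : Matrix n) → SameMatrix A (permuteRows (identity n) A)
permuteRows-identity {n} A i t = sym (trans
  (cong₂ (λ σ k → sgn σ ℤ.* A k t) (signs-identity n i) (perm-identity n i))
  (ℤ.*-identityˡ (A i t)))

permuteRows-MutuallyQU : (H : Matrix n) → IsHadamard n H →
  MutuallyQU n 1 (n * n) (2 ^ n * n !) (λ j → permuteRows (Inverse.from (SignedPerm↔Fin n) j) H)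
permuteRows-MutuallyQU {n} H H-had =
  (λ j → permuteRows-IsHadamard (code j) H H-had) ,
  (λ i j i≢j same → i≢j (code-injective (permuteRows-injective H H-had (code i) (code j) same))) ,
  (λ i j _ → permuteRows-QuasiUnbiased H H-had (code i) (code j))
  where
  code : Fin (2 ^ n * n !) → SignedPerm n
  code = Inverse.from (SignedPerm↔Fin n)
  code-injective : Injective _≡_ _≡_ code
  code-injective = Injection.injective (↔⇒↣ (↔-sym (SignedPerm↔Fin n)))

distinct-permuteRows-≤ : (H : Matrix n) (F : Fin m → Matrix n) →
  (∀ j → Σ (SignedPerm n) (λ c → SameMatrix (F j) (permuteRows c H))) →
  (∀ i j → i ≢ j → ¬ SameMatrix (F i) (F j)) → m ≤ 2 ^ n * n !
distinct-permuteRows-≤ {n} H F F≈cH distinct =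
  Fin.injective⇒≤ {f = Inverse.to (SignedPerm↔Fin n) ∘ code}
    (λ eq → code-injective (Injection.injective (↔⇒↣ (SignedPerm↔Fin n)) eq))
  where
  code : _ → SignedPerm n
  code j = proj₁ (F≈cH j)
  code-injective : Injective _≡_ _≡_ code
  code-injective {i} {j} ci≡cj with i Fin.≟ j
  ... | yes i≡j = i≡j
  ... | no i≢j  = ⊥-elim (distinct i j i≢j λ r t → begin
    F i r t                    ≡⟨ proj₂ (F≈cH i) r t ⟩
    permuteRows (code i) H r t ≡⟨ cong (λ c → permuteRows c H r t) ci≡cj ⟩
    permuteRows (code j) H r t ≡⟨ proj₂ (F≈cH j) r t ⟨
    F j r t                    ∎)
    where open ≡-Reasoning

proposition4p2 : (n : ℕ) → Σ (Matrix n) (IsHadamard n) →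
    Σ (Fin (2 ^ n * n !) → Matrix n) (MutuallyQU n 1 (n * n) (2 ^ n * n !))
    × ((m : ℕ) (F : Fin m → Matrix n) → MutuallyQU n 1 (n * n) m F → m ≤ 2 ^ n * n !)
proposition4p2 n (H , H-had) = (_ , permuteRows-MutuallyQU H H-had) , upperBound
  where
  upperBound : (m : ℕ) (F : Fin m → Matrix n) → MutuallyQU n 1 (n * n) m F → m ≤ 2 ^ n * n !
  upperBound zero    F _                   = z≤n
  upperBound (suc m) F (_ , distinct , qu) = distinct-permuteRows-≤ (F zero) F relative distinct
    where
    relative : ∀ j → Σ (SignedPerm n) (λ c → SameMatrix (F j) (permuteRows c (F zero)))
    relative zero    = identity n , permuteRows-identity (F zero)
    relative (suc j) = QuasiUnbiased⇒permuteRows (qu (suc j) zero λ ())
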